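{- For every $n$-vertex plane triangulation $G$, $\mathrm{msf}(G)\leq n-2$.
   Context: A (plane) triangulation is a simple planar graph with a fixed combinatorial plane embedding in which every face is bounded by a $3$-cycle. For an edge $vw$ with incident faces $(v,w,x)$ and $(w,v,y)$, flipping $vw$ means deleting $vw$ and adding the edge $xy$ embedded inside the quadrilateral formed by the two faces. For a set $S$ of edges, $\mathcal{F}(G,S)$ denotes the embedded graph obtained by flipping every edge of $S$; $S$ is flippable if $\mathcal{F}(G,S)$ is a triangulation (in particular simple). $\mathrm{msf}(G)$ denotes the maximum cardinality of a flippable set of edges of $G$. -}

module Defs where

open import Data.Nat using (ℕ; _+_; _<?_)
open import Data.Fin using (Fin; toℕ; _≟_)
open import Data.Bool using (Bool; true; false; if_then_else_; _∧_; _∨_; not)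
open import Data.Maybe using (Maybe; just; nothing; _<∣>_; is-just)
open import Data.Product using (_×_; _,_; proj₁; proj₂; ∃)
open import Data.List using (List; []; _∷_; _++_; concatMap; filter; length)
open import Data.Bool.ListAction using (any)
open import Data.List.Relation.Unary.All using (All)
open import Data.List.Relation.Unary.Any using (Any)
open import Data.List.Relation.Unary.Unique.Propositional using (Unique)
open import Data.List.Membership.Propositional using (_∈_)
open import Relation.Binary.PropositionalEquality using (_≡_; _≢_)
open import Relation.Binary.Construct.Closure.ReflexiveTransitive using (Star)
open import Relation.Nullary.Decidable using (⌊_⌋)

-- An oriented triangular face on vertex set Fin n: (a , b , c) has the
-- darts (directed edges) a→b, b→c, c→a.  A plane triangulation is given
-- by its list of faces (the combinatorial embedding).
Face : ℕ → Set
Face n = Fin n × Fin n × Fin n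

Dart : ℕ → Set
Dart n = Fin n × Fin n

module _ {n : ℕ} where

  faceDarts : Face n → List (Dart n)
  faceDarts (a , b , c) = (a , b) ∷ (b , c) ∷ (c , a) ∷ []

  darts : List (Face n) → List (Dart n)
  darts = concatMap faceDarts

  rotations : Face n → List (Face n)
  rotations (a , b , c) = (a , b , c) ∷ (b , c , a) ∷ (c , a , b) ∷ []

  numEdges : List (Face n) → ℕ
  numEdges F = length (filter (λ d → toℕ (proj₁ d) <? toℕ (proj₂ d)) (darts F))

  -- rotation at vertex v: neighbour a is followed by neighbour b
  -- iff (v , a , b) is a face
  Next : List (Face n) → Fin n → Fin n → Fin n → Set
  Next F v a b = Any (λ f → (v , a , b) ∈ rotations f) F

  Adj : List (Face n) → Fin n → Fin n → Set
  Adj F u w = (u , w) ∈ darts F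

-- F is (the face list of) a plane triangulation on exactly the vertex set Fin n:
-- faces are 3-cycles, every dart lies in exactly one face and its reverse
-- dart is present (so every edge borders two faces, consistently oriented,
-- and no parallel edges / loops: the graph is simple), every vertex is used,
-- the faces around every vertex form a single cycle (closed surface),
-- the graph is connected and Euler's formula V - E + F = 2 holds (sphere).
record IsTriangulation (n : ℕ) (F : List (Face n)) : Set where
  field
    faceDistinct : All (λ f → proj₁ f ≢ proj₁ (proj₂ f)
                            × proj₁ (proj₂ f) ≢ proj₂ (proj₂ f)
                            × proj₂ (proj₂ f) ≢ proj₁ f) F
    dartsUnique  : Unique (darts F)
    dartsSym     : ∀ u v → (u , v) ∈ darts F → (v , u) ∈ darts F
    allVertices  : ∀ v → ∃ λ u → (v , u) ∈ darts F
    linkCycle    : ∀ v a b → (v , a) ∈ darts F → (v , b) ∈ darts F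
                   → Star (Next F v) a b
    connected    : ∀ u w → Star (Adj F) u w
    euler        : n + length F ≡ numEdges F + 2

module _ {n : ℕ} where

  _==_ : Fin n → Fin n → Bool
  i == j = ⌊ i ≟ j ⌋

  apexFace : Face n → Fin n → Fin n → Maybe (Fin n)
  apexFace (a , b , c) u v =
    if (a == u) ∧ (b == v) then just c else
    if (b == u) ∧ (c == v) then just a else
    if (c == u) ∧ (a == v) then just b else nothing

  apex : List (Face n) → Fin n → Fin n → Maybe (Fin n)
  apex []      u v = nothing
  apex (f ∷ F) u v = apexFace f u v <∣> apex F u v

  hasDart : Face n → Fin n → Fin n → Bool
  hasDart f u v = is-just (apexFace f u v)

  touched : List (Dart n) → Face n → Bool
  touched S f = any (λ e → hasDart f (proj₁ e) (proj₂ e) ∨ hasDart f (proj₂ e) (proj₁ e)) S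

  -- flipping vw with faces (v,w,x), (w,v,y): these are replaced by the
  -- two faces (x,y,w) and (y,x,v) of the quadrilateral v y w x cut by xy
  newFaces : List (Face n) → Dart n → List (Face n)
  newFaces G (v , w) with apex G v w | apex G w v
  ... | just x | just y = (x , y , w) ∷ (y , x , v) ∷ []
  ... | _      | _      = []

  flipAll : List (Face n) → List (Dart n) → List (Face n)
  flipAll G S = filter (λ f → not (touched S f) Data.Bool.≟ true) G ++ concatMap (newFaces G) S

  IsEdge : List (Face n) → Dart n → Set
  IsEdge G (v , w) = (toℕ v Data.Nat.< toℕ w) × (v , w) ∈ darts G

record Flippable (n : ℕ) (G : List (Face n)) (S : List (Dart n)) : Set where
  field
    edges     : All (IsEdge G) S
    noRepeat  : Unique S
    resultTri : IsTriangulation n (flipAll G S)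

-- Flipping an edge deletes its two incident faces and creates two new ones, so the
-- face list of 𝓕(G,S) contains 2|S| new faces.  On the other hand, counting darts
-- gives 3F ≤ 2E for every triangulation (three darts per face, two per edge), which
-- with Euler's formula n + F = E + 2 bounds the number of faces by 2n - 4.
-- Hence 2|S| ≤ 2n - 4.
module Submission where

open import Defs
open import Data.Nat using (ℕ; _≤_; _∸_)
open import Data.List using (List; length)

open import Data.Nat using (suc; _+_; _*_; _<_; _<?_; z≤n; s≤s)
open import Data.Nat.Properties
  using ( +-suc; +-assoc; +-comm; +-identityʳ; *-suc; *-zeroʳ; *-distribˡ-+
        ; +-monoˡ-≤; +-monoʳ-≤; +-cancelˡ-≤; *-cancelˡ-≤; m≤n+m; m+n≤o⇒m≤o∸n
        ; ≤∧≢⇒<; ≮⇒≥; module ≤-Reasoning)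
open import Data.Fin using (Fin; toℕ; _≟_)
open import Data.Fin.Properties using (toℕ-injective)
open import Data.Bool using (Bool; true; false; if_then_else_; _∧_; not)
import Data.Bool
open import Data.Maybe using (Maybe; just; nothing)
open import Data.Product using (_,_; proj₁; proj₂; ∃-syntax; swap)
open import Data.Sum using (inj₁; inj₂)
open import Data.List using ([]; _∷_; _++_; concatMap; filter; map)
open import Data.List.Properties using (length-++; length-map)
open import Data.List.Relation.Unary.All as All using (All; []; _∷_)
open import Data.List.Relation.Unary.Any using (here; there)
open import Data.List.Relation.Unary.AllPairs using (_∷_)
open import Data.List.Relation.Unary.Unique.Propositional using (Unique)
import Data.List.Relation.Unary.Unique.Propositional.Properties as Unique
open import Data.List.Relation.Binary.Subset.Propositional using (_⊆_)
open import Data.List.Membership.Propositional using (_∈_)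
open import Data.List.Membership.Propositional.Properties
  using (∈-++⁻; ∈-++⁺ˡ; ∈-++⁺ʳ; ∈-∃++; ∈-map⁻; ∈-filter⁻; ∈-filter⁺)
open import Relation.Binary.PropositionalEquality
  using (_≡_; _≢_; refl; sym; trans; cong; cong₂; module ≡-Reasoning)
open import Relation.Nullary using (yes; no)
open import Relation.Nullary.Decidable using (dec-true; isYes≗does)
open import Relation.Unary using (Pred; Decidable)
open import Relation.Unary.Properties using (∁?)
open import Data.Empty using (⊥-elim)

module _ {A : Set} where

  length-filter+length-filter-∁ : ∀ {p} {P : Pred A p} (P? : Decidable P) (xs : List A) →
    length (filter P? xs) + length (filter (∁? P?) xs) ≡ length xs
  length-filter+length-filter-∁ P? [] = refl
  length-filter+length-filter-∁ P? (x ∷ xs) with P? x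
  ... | yes _ = cong suc (length-filter+length-filter-∁ P? xs)
  ... | no _  = trans (+-suc _ _) (cong suc (length-filter+length-filter-∁ P? xs))

  length-concatMap-const : {B : Set} {f : A → List B} {k : ℕ} {xs : List A} →
    All (λ x → length (f x) ≡ k) xs → length (concatMap f xs) ≡ k * length xs
  length-concatMap-const {k = k} {[]}     []             = sym (*-zeroʳ k)
  length-concatMap-const {f = f} {k} {x ∷ xs} (fx≡k ∷ fxs≡k) = begin
    length (f x ++ concatMap f xs)          ≡⟨ length-++ (f x) ⟩
    length (f x) + length (concatMap f xs)  ≡⟨ cong₂ _+_ fx≡k (length-concatMap-const fxs≡k) ⟩
    k + k * length xs                       ≡⟨ sym (*-suc k (length xs)) ⟩
    k * length (x ∷ xs)                     ∎
    where open ≡-Reasoning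

  Unique-⊆⇒length≤ : {xs ys : List A} → Unique xs → xs ⊆ ys → length xs ≤ length ys
  Unique-⊆⇒length≤ {[]}     _             _  = z≤n
  Unique-⊆⇒length≤ {x ∷ xs} (x∉xs ∷ uxs) xs⊆ys with ∈-∃++ (xs⊆ys (here refl))
  ... | as , bs , refl = begin
      suc (length xs)             ≤⟨ s≤s (Unique-⊆⇒length≤ uxs xs⊆as++bs) ⟩
      suc (length (as ++ bs))     ≡⟨ cong suc (length-++ as) ⟩
      suc (length as + length bs) ≡⟨ sym (+-suc (length as) (length bs)) ⟩
      length as + length (x ∷ bs) ≡⟨ sym (length-++ as) ⟩
      length (as ++ x ∷ bs)       ∎
    where
    open ≤-Reasoning
    xs⊆as++bs : xs ⊆ as ++ bs
    xs⊆as++bs y∈xs with ∈-++⁻ as (xs⊆ys (there y∈xs))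
    ... | inj₁ y∈as         = ∈-++⁺ˡ y∈as
    ... | inj₂ (here refl)  = ⊥-elim (All.lookup x∉xs y∈xs refl)
    ... | inj₂ (there y∈bs) = ∈-++⁺ʳ as y∈bs

faces+4≤2*vertices : ∀ n f e → n + f ≡ e + 2 → 3 * f ≤ 2 * e → f + 4 ≤ 2 * n
faces+4≤2*vertices n f e euler 3f≤2e = +-cancelˡ-≤ (2 * f) _ _ (begin
  2 * f + (f + 4)  ≡⟨ sym (+-assoc (2 * f) f 4) ⟩
  2 * f + f + 4    ≡⟨ cong (_+ 4) (+-comm (2 * f) f) ⟩
  3 * f + 4        ≤⟨ +-monoˡ-≤ 4 3f≤2e ⟩
  2 * e + 4        ≡⟨ sym (*-distribˡ-+ 2 e 2) ⟩
  2 * (e + 2)      ≡⟨ cong (2 *_) (sym euler) ⟩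
  2 * (n + f)      ≡⟨ *-distribˡ-+ 2 n f ⟩
  2 * n + 2 * f    ≡⟨ +-comm (2 * n) (2 * f) ⟩
  2 * f + 2 * n    ∎)
  where open ≤-Reasoning

module _ {n : ℕ} where

  length-darts : (F : List (Face n)) → length (darts F) ≡ 3 * length F
  length-darts []      = refl
  length-darts (f ∷ F) = begin
    length (faceDarts f ++ darts F)  ≡⟨ length-++ (faceDarts f) {darts F} ⟩
    3 + length (darts F)             ≡⟨ cong (3 +_) (length-darts F) ⟩
    3 + 3 * length F                 ≡⟨ sym (*-suc 3 (length F)) ⟩
    3 * length (f ∷ F)               ∎
    where open ≡-Reasoning

  darts-irreflexive : {F : List (Face n)} → IsTriangulation n F →
                      ∀ {u v} → (u , v) ∈ darts F → u ≢ v
  darts-irreflexive {F} T = go F (IsTriangulation.faceDistinct T)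
    where
    go : ∀ F → All _ F → ∀ {u v} → (u , v) ∈ darts F → u ≢ v
    go (f ∷ F) (f-proper ∷ F-proper) uv∈ with ∈-++⁻ (faceDarts f) uv∈
    ... | inj₁ (here refl)                 = proj₁ f-proper
    ... | inj₁ (there (here refl))         = proj₁ (proj₂ f-proper)
    ... | inj₁ (there (there (here refl))) = proj₂ (proj₂ f-proper)
    ... | inj₂ uv∈F                        = go F F-proper uv∈F

  3*faces≤2*edges : {F : List (Face n)} → IsTriangulation n F → 3 * length F ≤ 2 * numEdges F
  3*faces≤2*edges {F} T = begin
    3 * length F                    ≡⟨ sym (length-darts F) ⟩
    length (darts F)                ≡⟨ sym (length-filter+length-filter-∁ ascending? (darts F)) ⟩
    numEdges F + length descending  ≤⟨ +-monoʳ-≤ (numEdges F) length-descending≤numEdges ⟩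
    numEdges F + numEdges F         ≡⟨ cong (numEdges F +_) (sym (+-identityʳ (numEdges F))) ⟩
    2 * numEdges F                  ∎
    where
    open ≤-Reasoning
    open IsTriangulation T using (dartsUnique; dartsSym)

    ascending? : Decidable (λ (d : Dart n) → toℕ (proj₁ d) < toℕ (proj₂ d))
    ascending? d = toℕ (proj₁ d) <? toℕ (proj₂ d)

    descending : List (Dart n)
    descending = filter (∁? ascending?) (darts F)

    swap-descending⊆ascending : map swap descending ⊆ filter ascending? (darts F)
    swap-descending⊆ascending d∈ with ∈-map⁻ swap d∈
    ... | (u , v) , uv∈desc , refl with ∈-filter⁻ (∁? ascending?) {xs = darts F} uv∈desc
    ... | uv∈ , u≮v = ∈-filter⁺ ascending? (dartsSym u v uv∈) (≤∧≢⇒< (≮⇒≥ u≮v) v≢u)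
      where
      v≢u : toℕ v ≢ toℕ u
      v≢u v≡u = darts-irreflexive T uv∈ (toℕ-injective (sym v≡u))

    length-descending≤numEdges : length descending ≤ numEdges F
    length-descending≤numEdges = begin
      length descending              ≡⟨ sym (length-map swap descending) ⟩
      length (map swap descending)   ≤⟨ Unique-⊆⇒length≤ unique swap-descending⊆ascending ⟩
      numEdges F                     ∎
      where
      unique : Unique (map swap descending)
      unique = Unique.map⁺ (cong swap) (Unique.filter⁺ (∁? ascending?) dartsUnique)

  length-faces+4≤2*n : {F : List (Face n)} → IsTriangulation n F → length F + 4 ≤ 2 * n
  length-faces+4≤2*n {F} T =
    faces+4≤2*vertices n (length F) (numEdges F) (IsTriangulation.euler T) (3*faces≤2*edges T)

  ==-refl : (a : Fin n) → (a == a) ≡ true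
  ==-refl a = trans (isYes≗does (a ≟ a)) (dec-true (a ≟ a) refl)

  if-then-just-else-defined : ∀ (b : Bool) {x : Fin n} {m : Maybe (Fin n)} →
    ∃[ y ] m ≡ just y → ∃[ y ] (if b then just x else m) ≡ just y
  if-then-just-else-defined true  {x} _ = x , refl
  if-then-just-else-defined false m≡y   = m≡y

  apexFace-defined : (f : Face n) {u v : Fin n} → (u , v) ∈ faceDarts f →
                     ∃[ x ] apexFace f u v ≡ just x
  apexFace-defined (a , b , c) (here refl) rewrite ==-refl a | ==-refl b = c , refl
  apexFace-defined (a , b , c) (there (here refl)) rewrite ==-refl b | ==-refl c =
    if-then-just-else-defined ((a == b) ∧ (b == c)) (a , refl)
  apexFace-defined (a , b , c) (there (there (here refl))) rewrite ==-refl c | ==-refl a =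
    if-then-just-else-defined ((a == c) ∧ (b == a))
      (if-then-just-else-defined ((b == c) ∧ (c == a)) (b , refl))

  apex-defined : (G : List (Face n)) {u v : Fin n} → (u , v) ∈ darts G → ∃[ x ] apex G u v ≡ just x
  apex-defined (f ∷ G) {u} {v} uv∈ with ∈-++⁻ (faceDarts f) uv∈
  ... | inj₁ uv∈f with apexFace-defined f uv∈f
  ...   | x , apexFace≡x rewrite apexFace≡x = x , refl
  apex-defined (f ∷ G) {u} {v} uv∈ | inj₂ uv∈G with apexFace f u v
  ... | just x  = x , refl
  ... | nothing = apex-defined G uv∈G

  length-newFaces : {G : List (Face n)} → IsTriangulation n G →
                    ∀ {e} → IsEdge G e → length (newFaces G e) ≡ 2
  length-newFaces {G} T {v , w} (_ , vw∈)
    with apex-defined G vw∈ | apex-defined G (IsTriangulation.dartsSym T v w vw∈)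
  ... | x , apex-vw≡x | y , apex-wv≡y rewrite apex-vw≡x | apex-wv≡y = refl

  2*length≤length-flipAll : {G : List (Face n)} → IsTriangulation n G →
    {S : List (Dart n)} → All (IsEdge G) S → 2 * length S ≤ length (flipAll G S)
  2*length≤length-flipAll {G} T {S} S-edges = begin
    2 * length S                                          ≡⟨ sym (length-concatMap-const newFaces-pairs) ⟩
    length (concatMap (newFaces G) S)                     ≤⟨ m≤n+m _ (length untouched) ⟩
    length untouched + length (concatMap (newFaces G) S)  ≡⟨ sym (length-++ untouched) ⟩
    length (flipAll G S)                                  ∎
    where
    open ≤-Reasoning
    newFaces-pairs : All (λ e → length (newFaces G e) ≡ 2) S
    newFaces-pairs = All.map (length-newFaces T) S-edges
    untouched : List (Face n)
    untouched = filter (λ f → not (touched S f) Data.Bool.≟ true) G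

mainTheorem7 : (n : ℕ) (G : List (Face n)) → IsTriangulation n G →
    (S : List (Dart n)) → Flippable n G S → length S ≤ n ∸ 2
mainTheorem7 n G T S flippable = m+n≤o⇒m≤o∸n (length S) {2} {n} (*-cancelˡ-≤ 2 (begin
  2 * (length S + 2)          ≡⟨ *-distribˡ-+ 2 (length S) 2 ⟩
  2 * length S + 4            ≤⟨ +-monoˡ-≤ 4 (2*length≤length-flipAll T edges) ⟩
  length (flipAll G S) + 4    ≤⟨ length-faces+4≤2*n resultTri ⟩
  2 * n                       ∎))
  where
  open Flippable flippable
  open ≤-Reasoning
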